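{- Let $\mathcal P$ be a finite set of mutually independent random variables and $\mathcal A$ a finite set of events determined by $\mathcal P$. Consider an arbitrary execution of the parallel algorithm, and turn it into an execution of the sequential algorithm by performing the resamplings of each parallel step one after another in an arbitrary order; let $C$ be the log of this sequential execution and let $S_j$ be the set of time indices of $C$ corresponding to the resamplings done in step $j$ of the parallel algorithm. If $t\in S_j$, then the depth of the witness tree $\tau_C(t)$ is $j-1$.
   Context: For an event $A$ determined by $\mathcal P$, $\mathrm{vbl}(A)$ is the unique minimal set of variables determining it; an evaluation violates $A$ if it makes $A$ happen. The dependency graph $G$ on $\mathcal A$ joins $A\ne B$ iff $\mathrm{vbl}(A)\cap\mathrm{vbl}(B)\ne\emptyset$; $\Gamma(A)$ is the neighborhood of $A$ and $\Gamma^+(A)=\Gamma(A)\cup\{A\}$. Parallel algorithm: sample all variables independently; while some event is violated, perform a step: choose a maximal independent set $S$ in the subgraph of $G$ induced by the currently violated events and resample (replace by fresh independent samples) all variables in $\bigcup_{A\in S}\mathrm{vbl}(A)$. Sequential algorithm: repeatedly pick a violated event and resample the variables of that event only; its log is the sequence $C(1),C(2),\dots$ of events resampled. A witness tree is a finite rooted tree with vertex labels $[v]\in\mathcal A$ such that each child of $u$ has label in $\Gamma^+([u])$; its depth is the maximum distance of a vertex from the root. The tree $\tau_C(t)$: start with a single root labelled $C(t)$; for $i=t-1,\dots,1$, if the current tree has a vertex $v$ with $C(i)\in\Gamma^+([v])$, choose such $v$ at maximum distance from the root (ties broken arbitrarily) and attach a new child of $v$ labelled $C(i)$; otherwise do nothing.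 -}

module Defs where

open import Data.Nat using (ℕ; zero; suc; _∸_; _≤_; _<_; _⊔_)
open import Data.Fin using (Fin; zero; suc)
open import Data.Fin.Subset using (Subset; _∈_; _∉_; _⊆_)
open import Data.List using (List; []; _∷_; length; concat; applyUpTo; take; reverse)
open import Data.List.Membership.Propositional renaming (_∈_ to _∈ₗ_; _∉_ to _∉ₗ_)
open import Data.List.Relation.Unary.Unique.Propositional using (Unique)
open import Data.Maybe using (Maybe; just; nothing)
open import Data.Product using (Σ; ∃; _×_; _,_)
open import Data.Sum using (_⊎_)
open import Relation.Nullary using (¬_)
open import Relation.Binary.PropositionalEquality using (_≡_; _≢_)

-- An event is given by the predicate "A happens"
-- on evaluations; vbl A is the unique minimal set of variables
-- determining A.  (Probabilities play no role in the statement: an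
-- execution is any sequence of evaluations in which only the resampled
-- variables change, the fresh values being arbitrary.)

record System : Set₁ where
  field
    nv ne   : ℕ
    Val     : Fin nv → Set
    happens : Fin ne → ((x : Fin nv) → Val x) → Set
    vbl     : Fin ne → Subset nv
    vbl-determines : ∀ A (σ σ' : (x : Fin nv) → Val x) →
      (∀ x → x ∈ vbl A → σ x ≡ σ' x) → happens A σ → happens A σ'
    vbl-minimal : ∀ A (X : Subset nv) →
      (∀ (σ σ' : (x : Fin nv) → Val x) →
        (∀ x → x ∈ X → σ x ≡ σ' x) → happens A σ → happens A σ') →
      vbl A ⊆ X

-- A tree with
-- suc k vertices, built by successively attaching new leaves: the
-- newest vertex has index zero, `attach τ p a` adds a new child of
-- vertex p labelled a.

data WT (ne : ℕ) : ℕ → Set where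
  root   : Fin ne → WT ne 0
  attach : ∀ {k} → WT ne k → Fin (suc k) → Fin ne → WT ne (suc k)

label : ∀ {ne k} → WT ne k → Fin (suc k) → Fin ne
label (root a)       zero    = a
label (attach τ p a) zero    = a
label (attach τ p a) (suc v) = label τ v

dist : ∀ {ne k} → WT ne k → Fin (suc k) → ℕ
dist (root a)       zero    = 0
dist (attach τ p a) zero    = suc (dist τ p)
dist (attach τ p a) (suc v) = dist τ v

maxOver : ∀ {k} → (Fin (suc k) → ℕ) → ℕ
maxOver {zero}  f = f zero
maxOver {suc k} f = f zero ⊔ maxOver (λ v → f (suc v))

depth : ∀ {ne k} → WT ne k → ℕ
depth τ = maxOver (dist τ)

nth : ∀ {A : Set} → List A → ℕ → Maybe A
nth []       _       = nothing
nth (x ∷ xs) zero    = just x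
nth (x ∷ xs) (suc i) = nth xs i

module _ (𝒮 : System) where
  open System 𝒮

  Eval : Set
  Eval = (x : Fin nv) → Val x

  Adj : Fin ne → Fin ne → Set
  Adj A B = A ≢ B × ∃ λ x → x ∈ vbl A × x ∈ vbl B

  InΓ⁺ : Fin ne → Fin ne → Set
  InΓ⁺ A B = A ≡ B ⊎ Adj B A

  -- The loop of the construction of τ_C(t): process the remaining events
  -- (C(t-1), C(t-2), …, C(1), in this order) starting from tree τ,
  -- ending in the final tree.  Ties are broken arbitrarily (any vertex of
  -- maximum distance may be chosen).
  data Grow : List (Fin ne) → Σ ℕ (WT ne) → Σ ℕ (WT ne) → Set where
    done : ∀ {τ} → Grow [] τ τ
    add  : ∀ {a as k τ res} (v : Fin (suc k)) →
           InΓ⁺ a (label τ v) →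
           (∀ w → InΓ⁺ a (label τ w) → dist τ w ≤ dist τ v) →
           Grow as (suc k , attach τ v a) res →
           Grow (a ∷ as) (k , τ) res
    skip : ∀ {a as k τ res} →
           (∀ w → ¬ InΓ⁺ a (label τ w)) →
           Grow as (k , τ) res →
           Grow (a ∷ as) (k , τ) res

  -- τ is a possible outcome of the construction of τ_C(t)
  -- (t is 1-based: C(t) = nth C (t ∸ 1)).
  IsτC : List (Fin ne) → ℕ → Σ ℕ (WT ne) → Set
  IsτC C t τ = 1 ≤ t × ∃ λ a → nth C (t ∸ 1) ≡ just a ×
               Grow (reverse (take (t ∸ 1) C)) (0 , root a) τ

  -- An execution of the parallel algorithm with N steps.
  -- σ 0 is the initial evaluation, σ j the evaluation after step j;
  -- step (suc j) resamples the events of S (suc j), listed in the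
  -- (arbitrary) order used for the sequential execution.
  record ParallelExecution : Set where
    field
      N : ℕ
      σ : ℕ → Eval
      S : ℕ → List (Fin ne)
      running     : ∀ j → j < N → ∃ λ A → happens A (σ j)
      -- S (suc j) is a maximal independent set of the subgraph of G
      -- induced by the events violated at σ j
      unique      : ∀ j → j < N → Unique (S (suc j))
      violated    : ∀ j → j < N → ∀ A → A ∈ₗ S (suc j) → happens A (σ j)
      independent : ∀ j → j < N → ∀ A B → A ∈ₗ S (suc j) → B ∈ₗ S (suc j) →
                    ¬ Adj A B
      maximal     : ∀ j → j < N → ∀ A → happens A (σ j) → A ∉ₗ S (suc j) →
                    ∃ λ B → B ∈ₗ S (suc j) × Adj A B
      resample    : ∀ j → j < N → ∀ x →
                    (∀ A → A ∈ₗ S (suc j) → x ∉ vbl A) → σ (suc j) x ≡ σ j x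

  module _ (E : ParallelExecution) where
    open ParallelExecution E

    logUpTo : ℕ → List (Fin ne)
    logUpTo j = concat (applyUpTo (λ i → S (suc i)) j)

    log : List (Fin ne)
    log = logUpTo N

    -- t ∈ S_j : the time index t (1-based) of C corresponds to step j
    _∈Step_ : ℕ → ℕ → Set
    t ∈Step j = 1 ≤ j × j ≤ N × length (logUpTo (j ∸ 1)) < t × t ≤ length (logUpTo j)

-- The events resampled in one step form an
-- independent set, so while τ_C(t) processes the events of a step, a new vertex is never attached
-- below a vertex that carries an event of the same step: every step adds at most one level.
-- Conversely an event resampled in step j+1 was violated after step j, and a violated event has
-- an event resampled in step j in its Γ⁺ (otherwise it was already violated before step j,
-- contradicting maximality); hence every step adds at least one level.  The events of step j
-- that precede t are independent of C(t) and leave the root alone.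
module Submission where

open import Defs
open import Data.Nat using (ℕ; zero; suc; _+_; _∸_; _≤_; _<_; _≤′_; ≤′-refl; ≤′-step; z≤n; s≤s)
open import Data.Nat.Properties
  using (≤-refl; ≤-trans; ≤-antisym; ≤-pred; m≤n⇒m≤1+n; n≤1+n; ≤⇒≤′; ⊔-lub; m≤m⊔n; m≤n⊔m
        ; +-suc; +-identityʳ)
open import Data.Fin using (Fin; zero; suc)
open import Data.Fin.Subset using (_∈_)
open import Data.Fin.Subset.Properties using (_∈?_)
import Data.Fin.Properties as Fin
open import Data.List using (List; []; _∷_; _++_; length; take; reverse; concat; applyUpTo)
open import Data.List.Properties using (reverse-++; ++-assoc; ++-identityʳ; applyUpTo-∷ʳ; concat-++)
open import Data.List.Membership.Propositional using (lose) renaming (_∈_ to _∈ₗ_; _∉_ to _∉ₗ_)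
open import Data.List.Relation.Unary.Any using (Any; here; there; any?)
open import Data.List.Relation.Unary.Any.Properties using (reverse⁺; reverse⁻; ++⁺ʳ; ++⁺ˡ)
open import Data.List.Relation.Unary.All using (All; []; _∷_)
import Data.List.Relation.Unary.All as All
open import Data.List.Relation.Unary.AllPairs using ([]; _∷_)
open import Data.List.Relation.Unary.Unique.Propositional using (Unique)
open import Data.List.Relation.Binary.Permutation.Propositional using (↭⇒↭ₛ; ↭-sym)
open import Data.List.Relation.Binary.Permutation.Propositional.Properties using (↭-reverse)
open import Data.List.Relation.Binary.Permutation.Setoid.Properties using (Unique-resp-↭)
open import Data.Maybe using (just)
open import Data.Product using (Σ; ∃; ∃₂; _×_; _,_; proj₁; proj₂)
open import Data.Sum using (_⊎_; inj₁; inj₂)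
open import Data.Empty using (⊥-elim)
open import Relation.Nullary using (¬_; Dec; yes; no; contradiction)
open import Relation.Nullary.Decidable using (_×-dec_; _⊎-dec_; ¬?)
open import Relation.Binary.PropositionalEquality
  using (_≡_; refl; sym; trans; cong; subst; setoid; module ≡-Reasoning)

maxOver-lub : ∀ {k} (f : Fin (suc k) → ℕ) {e} → (∀ v → f v ≤ e) → maxOver f ≤ e
maxOver-lub {zero}  f f≤e = f≤e zero
maxOver-lub {suc k} f f≤e = ⊔-lub (f≤e zero) (maxOver-lub (λ v → f (suc v)) (λ v → f≤e (suc v)))

≤-maxOver : ∀ {k} (f : Fin (suc k) → ℕ) v → f v ≤ maxOver f
≤-maxOver {zero}  f zero    = ≤-refl
≤-maxOver {suc k} f zero    = m≤m⊔n _ _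
≤-maxOver {suc k} f (suc v) = ≤-trans (≤-maxOver (λ v → f (suc v)) v) (m≤n⊔m (f zero) _)

Unique-reverse : ∀ {A : Set} {xs : List A} → Unique xs → Unique (reverse xs)
Unique-reverse {A} {xs} = Unique-resp-↭ (setoid A) (↭⇒↭ₛ (↭-sym (↭-reverse xs)))

Unique-++-∷⇒∉ : ∀ {A : Set} (P : List A) {a Q} → Unique (P ++ a ∷ Q) → a ∉ₗ P
Unique-++-∷⇒∉ (x ∷ P) (x∉ ∷ _) (here refl) = All.lookup x∉ (++⁺ʳ P (here refl)) refl
Unique-++-∷⇒∉ (x ∷ P) (_ ∷ u)  (there a∈P) = Unique-++-∷⇒∉ P u a∈P

nth-in-block : ∀ {A : Set} (L B R : List A) {i a} → length L ≤ i → i < length (L ++ B) →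
  nth (L ++ B ++ R) i ≡ just a → ∃₂ λ P Q → B ≡ P ++ a ∷ Q × take i (L ++ B ++ R) ≡ L ++ P
nth-in-block (x ∷ L) B R {suc i} (s≤s L≤i) (s≤s i<LB) nth≡
  with nth-in-block L B R L≤i i<LB nth≡
... | P , Q , B≡ , take≡ = P , Q , B≡ , cong (x ∷_) take≡
nth-in-block [] (b ∷ B) R {zero} _ _ refl = [] , B , refl , refl
nth-in-block [] (b ∷ B) R {suc i} _ (s≤s i<B) nth≡
  with nth-in-block [] B R z≤n i<B nth≡
... | P , Q , B≡ , take≡ = b ∷ P , Q , cong (b ∷_) B≡ , cong (b ∷_) take≡

module _ (𝒮 : System) where
  open System 𝒮

  Tree : Set
  Tree = Σ ℕ (WT ne)

  Height≤ : Tree → ℕ → Set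
  Height≤ τ d = ∀ w → dist (proj₂ τ) w ≤ d

  record Reaches (τ : Tree) (d : ℕ) (P : Fin ne → Set) : Set where
    constructor reaches
    field
      vertex : Fin (suc (proj₁ τ))
      deep   : d ≤ dist (proj₂ τ) vertex
      holds  : P (label (proj₂ τ) vertex)

  depth-≡ : ∀ {τ d P} → Height≤ τ d → Reaches τ d P → depth (proj₂ τ) ≡ d
  depth-≡ {τ} height≤ (reaches w d≤w _) =
    ≤-antisym (maxOver-lub (dist (proj₂ τ)) height≤) (≤-trans d≤w (≤-maxOver (dist (proj₂ τ)) w))

  reaches-map : ∀ {τ d} {P P′ : Fin ne → Set} → (∀ {A} → P A → P′ A) → Reaches τ d P → Reaches τ d P′
  reaches-map f (reaches w d≤w p) = reaches w d≤w (f p)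

  Independent : (Fin ne → Set) → Set
  Independent Q = ∀ A B → Q A → Q B → ¬ Adj 𝒮 A B

  HitsΓ⁺ : List (Fin ne) → Fin ne → Set
  HitsΓ⁺ xs A = Any (λ B → InΓ⁺ 𝒮 B A) xs

  InΓ⁺? : ∀ A B → Dec (InΓ⁺ 𝒮 A B)
  InΓ⁺? A B = (A Fin.≟ B) ⊎-dec (¬? (B Fin.≟ A) ×-dec Fin.any? (λ x → (x ∈? vbl B) ×-dec (x ∈? vbl A)))

  shared⇒InΓ⁺ : ∀ {A B x} → x ∈ vbl A → x ∈ vbl B → InΓ⁺ 𝒮 B A
  shared⇒InΓ⁺ {A} {B} x∈A x∈B with B Fin.≟ A
  ... | yes B≡A = inj₁ B≡A
  ... | no B≢A  = inj₂ ((λ A≡B → B≢A (sym A≡B)) , _ , x∈A , x∈B)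

  Grow-++⁻ : ∀ xs ys {τ res} → Grow 𝒮 (xs ++ ys) τ res → ∃ λ mid → Grow 𝒮 xs τ mid × Grow 𝒮 ys mid res
  Grow-++⁻ []       ys grow = _ , done , grow
  Grow-++⁻ (x ∷ xs) ys (add v a∈Γ⁺ deepest grow) with Grow-++⁻ xs ys grow
  ... | mid , front , back = mid , add v a∈Γ⁺ deepest front , back
  Grow-++⁻ (x ∷ xs) ys (skip a∉Γ⁺ grow) with Grow-++⁻ xs ys grow
  ... | mid , front , back = mid , skip a∉Γ⁺ front , back

  Grow-root : ∀ {a} xs → (∀ {b} → b ∈ₗ xs → ¬ InΓ⁺ 𝒮 b a) → ∀ {res} →
              Grow 𝒮 xs (0 , root a) res → res ≡ (0 , root a)
  Grow-root []       _    done                = refl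
  Grow-root (b ∷ xs) away (add zero b∈Γ⁺ _ _) = ⊥-elim (away (here refl) b∈Γ⁺)
  Grow-root (b ∷ xs) away (skip _ grow)       = Grow-root xs (λ b∈xs → away (there b∈xs)) grow

  -- Invariant while the events xs of an independent set Q are processed, starting from a tree of
  -- height d: a vertex deeper than d carries an event of Q that has already been processed.
  data Placed (d : ℕ) (Q : Fin ne → Set) (xs : List (Fin ne)) (δ : ℕ) (A : Fin ne) : Set where
    shallow   : δ ≤ d → Placed d Q xs δ A
    processed : δ ≤ suc d → Q A → A ∉ₗ xs → Placed d Q xs δ A

  Placed-∷⁻ : ∀ {d Q a xs δ A} → Placed d Q (a ∷ xs) δ A → Placed d Q xs δ A
  Placed-∷⁻ (shallow δ≤d)            = shallow δ≤d
  Placed-∷⁻ (processed δ≤d+1 q A∉)   = processed δ≤d+1 q (λ A∈xs → A∉ (there A∈xs))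

  Placed⇒≤ : ∀ {d Q xs δ A} → Placed d Q xs δ A → δ ≤ suc d
  Placed⇒≤ (shallow δ≤d)          = m≤n⇒m≤1+n δ≤d
  Placed⇒≤ (processed δ≤d+1 _ _)  = δ≤d+1

  Grow-placed : ∀ {d Q xs τ res} → Independent Q → All Q xs → Unique xs → Grow 𝒮 xs τ res →
    (∀ w → Placed d Q xs (dist (proj₂ τ) w) (label (proj₂ τ) w)) → Height≤ res (suc d)
  Grow-placed _ [] [] done placed w = Placed⇒≤ (placed w)
  Grow-placed {d} {Q} {a ∷ xs} {_ , τ} indep (qa ∷ qs) (a∉ ∷ unique) (add v a∈Γ⁺ _ grow) placed =
    Grow-placed indep qs unique grow placed′
    where
    parent-shallow : Placed d Q (a ∷ xs) (dist τ v) (label τ v) → dist τ v ≤ d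
    parent-shallow (shallow v≤d)         = v≤d
    parent-shallow (processed _ qv v∉)   = ⊥-elim (a∉Γ⁺v a∈Γ⁺)
      where
      a∉Γ⁺v : ¬ InΓ⁺ 𝒮 a (label τ v)
      a∉Γ⁺v (inj₁ a≡v) = v∉ (here (sym a≡v))
      a∉Γ⁺v (inj₂ adj) = indep _ _ qv qa adj

    placed′ : ∀ w → Placed d Q xs (dist (attach τ v a) w) (label (attach τ v a) w)
    placed′ zero    =
      processed (s≤s (parent-shallow (placed v))) qa (λ a∈xs → All.lookup a∉ a∈xs refl)
    placed′ (suc w) = Placed-∷⁻ (placed w)
  Grow-placed indep (_ ∷ qs) (_ ∷ unique) (skip _ grow) placed =
    Grow-placed indep qs unique grow (λ w → Placed-∷⁻ (placed w))

  Grow-height≤ : ∀ {d Q xs τ res} → Independent Q → All Q xs → Unique xs → Grow 𝒮 xs τ res →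
    Height≤ τ d → Height≤ res (suc d)
  Grow-height≤ indep qs unique grow height≤ =
    Grow-placed indep qs unique grow (λ w → shallow (height≤ w))

  Deep : ℕ → (Fin ne → Set) → List (Fin ne) → Tree → Set
  Deep d Q xs τ = Reaches τ (suc d) Q ⊎ Reaches τ d (HitsΓ⁺ xs)

  -- An event of xs in Γ⁺ of a vertex at depth ≥ d is attached at depth ≥ d + 1,
  -- because it goes to a deepest vertex whose label has it in Γ⁺.
  Grow-reaches : ∀ {d Q xs τ res} → All Q xs → Grow 𝒮 xs τ res → Deep d Q xs τ → Reaches res (suc d) Q
  Grow-reaches [] done (inj₁ reached)              = reached
  Grow-reaches [] done (inj₂ (reaches _ _ ()))
  Grow-reaches {d} {Q} {a ∷ xs} {k , τ} (qa ∷ qs) (add v _ deepest grow) deep =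
    Grow-reaches qs grow (attach-deep deep)
    where
    attach-deep : Deep d Q (a ∷ xs) (k , τ) → Deep d Q xs (suc k , attach τ v a)
    attach-deep (inj₁ (reaches w d<w q))              = inj₁ (reaches (suc w) d<w q)
    attach-deep (inj₂ (reaches w d≤w (here a∈Γ⁺w)))  =
      inj₁ (reaches zero (s≤s (≤-trans d≤w (deepest w a∈Γ⁺w))) qa)
    attach-deep (inj₂ (reaches w d≤w (there hit)))   = inj₂ (reaches (suc w) d≤w hit)
  Grow-reaches {d} {Q} {a ∷ xs} {τ} (_ ∷ qs) (skip a∉Γ⁺ grow) deep =
    Grow-reaches qs grow (skip-deep deep)
    where
    skip-deep : Deep d Q (a ∷ xs) τ → Deep d Q xs τ
    skip-deep (inj₁ reached)                         = inj₁ reached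
    skip-deep (inj₂ (reaches w _ (here a∈Γ⁺w)))      = ⊥-elim (a∉Γ⁺ w a∈Γ⁺w)
    skip-deep (inj₂ (reaches w d≤w (there hit)))     = inj₂ (reaches w d≤w hit)

  module _ (E : ParallelExecution 𝒮) where
    open ParallelExecution E

    logUpTo-suc : ∀ n → logUpTo 𝒮 E (suc n) ≡ logUpTo 𝒮 E n ++ S (suc n)
    logUpTo-suc n = begin
      concat (applyUpTo f (suc n))             ≡⟨ cong concat (sym (applyUpTo-∷ʳ f n)) ⟩
      concat (applyUpTo f n ++ f n ∷ [])       ≡⟨ sym (concat-++ (applyUpTo f n) (f n ∷ [])) ⟩
      concat (applyUpTo f n) ++ (f n ++ [])    ≡⟨ cong (concat (applyUpTo f n) ++_) (++-identityʳ (f n)) ⟩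
      concat (applyUpTo f n) ++ f n            ∎
      where
      open ≡-Reasoning
      f : ℕ → List (Fin ne)
      f i = S (suc i)

    reverse-logUpTo-suc : ∀ n →
      reverse (logUpTo 𝒮 E (suc n)) ≡ reverse (S (suc n)) ++ reverse (logUpTo 𝒮 E n)
    reverse-logUpTo-suc n =
      trans (cong reverse (logUpTo-suc n)) (reverse-++ (logUpTo 𝒮 E n) (S (suc n)))

    logUpTo-prefix : ∀ {m n} → m ≤′ n → ∃ λ R → logUpTo 𝒮 E n ≡ logUpTo 𝒮 E m ++ R
    logUpTo-prefix ≤′-refl = [] , sym (++-identityʳ _)
    logUpTo-prefix {m} (≤′-step {n} m≤′n) with logUpTo-prefix m≤′n
    ... | R , prefix = R ++ S (suc n) , (begin
      logUpTo 𝒮 E (suc n)                       ≡⟨ logUpTo-suc n ⟩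
      logUpTo 𝒮 E n ++ S (suc n)                ≡⟨ cong (_++ S (suc n)) prefix ⟩
      (logUpTo 𝒮 E m ++ R) ++ S (suc n)         ≡⟨ ++-assoc (logUpTo 𝒮 E m) R (S (suc n)) ⟩
      logUpTo 𝒮 E m ++ R ++ S (suc n)           ∎)
      where open ≡-Reasoning

    log-around-step : ∀ {j} → j < N → ∃ λ R → log 𝒮 E ≡ logUpTo 𝒮 E j ++ S (suc j) ++ R
    log-around-step {j} j<N with logUpTo-prefix (≤⇒≤′ j<N)
    ... | R , prefix = R , (begin
      log 𝒮 E                                  ≡⟨ prefix ⟩
      logUpTo 𝒮 E (suc j) ++ R                 ≡⟨ cong (_++ R) (logUpTo-suc j) ⟩
      (logUpTo 𝒮 E j ++ S (suc j)) ++ R        ≡⟨ ++-assoc (logUpTo 𝒮 E j) (S (suc j)) R ⟩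
      logUpTo 𝒮 E j ++ S (suc j) ++ R          ∎)
      where open ≡-Reasoning

    log-position : ∀ {j t a} → j < N → length (logUpTo 𝒮 E j) ≤ t → t < length (logUpTo 𝒮 E (suc j)) →
      nth (log 𝒮 E) t ≡ just a →
      ∃₂ λ P Q → S (suc j) ≡ P ++ a ∷ Q × take t (log 𝒮 E) ≡ logUpTo 𝒮 E j ++ P
    log-position {j} {t} {a} j<N L≤t t<LS nth≡ with log-around-step j<N
    ... | R , log≡ with nth-in-block (logUpTo 𝒮 E j) (S (suc j)) R L≤t
                          (subst (λ xs → t < length xs) (logUpTo-suc j) t<LS)
                          (subst (λ xs → nth xs t ≡ just a) log≡ nth≡)
    ... | P , Q , S≡ , take≡ = P , Q , S≡ , trans (cong (take t) log≡) take≡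

    violated⇒hitsΓ⁺ : ∀ k → k < N → ∀ A → happens A (σ (suc k)) → HitsΓ⁺ (S (suc k)) A
    violated⇒hitsΓ⁺ k k<N A violated with any? (λ B → InΓ⁺? B A) (S (suc k))
    ... | yes hit  = hit
    ... | no  miss = contradiction (adjacent⇒hit (maximal k k<N A violated-before A∉S)) miss
      where
      untouched : ∀ x → x ∈ vbl A → σ (suc k) x ≡ σ k x
      untouched x x∈A = resample k k<N x (λ B B∈S x∈B → miss (lose B∈S (shared⇒InΓ⁺ x∈A x∈B)))

      violated-before : happens A (σ k)
      violated-before = vbl-determines A _ _ untouched violated

      A∉S : A ∉ₗ S (suc k)
      A∉S A∈S = miss (lose A∈S (inj₁ refl))

      adjacent⇒hit : (∃ λ B → B ∈ₗ S (suc k) × Adj 𝒮 A B) → HitsΓ⁺ (S (suc k)) A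
      adjacent⇒hit (B , B∈S , adj) = lose B∈S (inj₂ adj)

    Grow-within-step : ∀ {j t a τ} → j < N → length (logUpTo 𝒮 E j) ≤ t →
      t < length (logUpTo 𝒮 E (suc j)) → nth (log 𝒮 E) t ≡ just a →
      Grow 𝒮 (reverse (take t (log 𝒮 E))) (0 , root a) τ →
      a ∈ₗ S (suc j) × Grow 𝒮 (reverse (logUpTo 𝒮 E j)) (0 , root a) τ
    Grow-within-step {j} {t} {a} {τ} j<N L≤t t<LS nth≡ grow with log-position j<N L≤t t<LS nth≡
    ... | P , Q , S≡ , take≡
      with Grow-++⁻ (reverse P) _ (subst (λ xs → Grow 𝒮 xs (0 , root a) τ) split grow)
      where
      split : reverse (take t (log 𝒮 E)) ≡ reverse P ++ reverse (logUpTo 𝒮 E j)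
      split = trans (cong reverse take≡) (reverse-++ (logUpTo 𝒮 E j) P)
    ... | _ , same-step , earlier-steps =
      a∈S , subst (λ τ₀ → Grow 𝒮 (reverse (logUpTo 𝒮 E j)) τ₀ τ)
                  (Grow-root (reverse P) apart same-step) earlier-steps
      where
      a∈S : a ∈ₗ S (suc j)
      a∈S = subst (a ∈ₗ_) (sym S≡) (++⁺ʳ P (here refl))

      apart : ∀ {b} → b ∈ₗ reverse P → ¬ InΓ⁺ 𝒮 b a
      apart b∈P (inj₁ refl)     = Unique-++-∷⇒∉ P (subst Unique S≡ (unique j j<N)) (reverse⁻ b∈P)
      apart {b} b∈P (inj₂ adj) = independent j j<N _ _ a∈S b∈S adj
        where
        b∈S : b ∈ₗ S (suc j)
        b∈S = subst (_ ∈ₗ_) (sym S≡) (++⁺ˡ {ys = a ∷ Q} (reverse⁻ b∈P))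

    Grow-log : ∀ k d → k < N → ∀ {τ res} → Grow 𝒮 (reverse (logUpTo 𝒮 E k)) τ res →
      Height≤ τ d → Reaches τ d (_∈ₗ S (suc k)) → Height≤ res (d + k) × Reaches res (d + k) (_∈ₗ S 1)
    Grow-log zero d _ done height≤ reach rewrite +-identityʳ d = height≤ , reach
    Grow-log (suc k) d k+1<N {τ} {res} grow height≤ reach
      with Grow-++⁻ (reverse (S (suc k))) _
             (subst (λ xs → Grow 𝒮 xs τ res) (reverse-logUpTo-suc k) grow)
    ... | _ , step , earlier rewrite +-suc d k =
      Grow-log k (suc d) k<N earlier
        (Grow-height≤ indep inS (Unique-reverse (unique k k<N)) step height≤)
        (Grow-reaches inS step (inj₂ (reaches-map hits reach)))
      where
      k<N : k < N
      k<N = ≤-trans (n≤1+n _) k+1<N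

      indep : Independent (_∈ₗ S (suc k))
      indep = independent k k<N

      inS : All (_∈ₗ S (suc k)) (reverse (S (suc k)))
      inS = All.tabulate reverse⁻

      hits : ∀ {A} → A ∈ₗ S (suc (suc k)) → HitsΓ⁺ (reverse (S (suc k))) A
      hits A∈S = reverse⁺ (violated⇒hitsΓ⁺ k k<N _ (violated (suc k) k+1<N _ A∈S))

lemma4p1 : (𝒮 : System) (E : ParallelExecution 𝒮) (j t : ℕ) →
    _∈Step_ 𝒮 E t j →
    (τ : Σ ℕ (WT (System.ne 𝒮))) → IsτC 𝒮 (log 𝒮 E) t τ →
    depth (proj₂ τ) ≡ j ∸ 1
lemma4p1 𝒮 E (suc j) (suc t) (_ , j<N , L<t+1 , t<LS) τ (_ , a , nth≡ , grow)
  with Grow-within-step 𝒮 E j<N (≤-pred L<t+1) t<LS nth≡ grow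
... | a∈S , grow′ with Grow-log 𝒮 E j 0 j<N grow′ (λ { zero → z≤n }) (reaches zero z≤n a∈S)
... | height≤ , reach = depth-≡ 𝒮 height≤ reach
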